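{- $fsmp(G(4^2,4))=3$ and $fmp(G(4^2,4))=4$.
   Context: The recursive circulant graph $G(16,4)=G(4^2,4)$ has vertex set $\{0,\dots,15\}$, with $u,v$ adjacent iff $u-v\equiv\pm1$ or $\pm4\pmod{16}$. A fractional perfect matching of $G$ is $g:E(G)\to[0,1]$ with $\sum_{e\ni v}g(e)=1$ for all $v$. $fmp(G)$ (resp. $fsmp(G)$) is the minimum size of a set $F\subseteq E(G)$ (resp. $F\subseteq V(G)\cup E(G)$) whose deletion (vertices with incident edges, and edges) leaves a graph with no fractional perfect matching.
   Formalization: The weights of a fractional perfect matching are rational numbers in [0,1]. -}

module Defs where

open import Data.Nat using (ℕ; _+_; _∸_; _<_; _≤_)
open import Data.Nat.DivMod using (_%_)
open import Data.Fin using (Fin; toℕ)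
open import Data.List using (List; foldr; allFin; length)
open import Data.List.Membership.Propositional using (_∈_; _∉_)
open import Data.List.Relation.Unary.All using (All)
open import Data.List.Relation.Unary.Unique.Propositional using (Unique)
open import Data.Product using (_×_; _,_; Σ)
open import Data.Sum using (_⊎_)
open import Data.Rational using (ℚ; 0ℚ; 1ℚ) renaming (_+_ to _+ℚ_; _≤_ to _≤ℚ_)
open import Relation.Binary.PropositionalEquality using (_≡_)
open import Relation.Nullary using (¬_)

-- Vertices of the recursive circulant graph G(16,4) = G(4^2,4).
V : Set
V = Fin 16

diff : V → V → ℕ
diff u v = (16 + toℕ v ∸ toℕ u) % 16

Adj : V → V → Set
Adj u v = diff u v ≡ 1 ⊎ diff u v ≡ 15 ⊎ diff u v ≡ 4 ⊎ diff u v ≡ 12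

-- An edge {u,v} of G is represented canonically as the ordered pair (u , v) with u < v.
IsEdge : V × V → Set
IsEdge (u , v) = toℕ u < toℕ v × Adj u v

record EdgeSet : Set where
  field
    edges  : List (V × V)
    valid  : All IsEdge edges
    unique : Unique edges
open EdgeSet public

record VertexSet : Set where
  field
    verts  : List V
    vuniq  : Unique verts
open VertexSet public

EdgeIn : VertexSet → EdgeSet → V → V → Set
EdgeIn S D u v =
  Adj u v × u ∉ verts S × v ∉ verts S × (u , v) ∉ edges D × (v , u) ∉ edges D

Σᵥ : (V → ℚ) → ℚ
Σᵥ f = foldr (λ u acc → f u +ℚ acc) 0ℚ (allFin 16)

record FPM (S : VertexSet) (D : EdgeSet) : Set where
  field
    g        : V → V → ℚ
    sym      : ∀ u v → g u v ≡ g v u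
    support  : ∀ u v → ¬ EdgeIn S D u v → g u v ≡ 0ℚ
    nonneg   : ∀ u v → 0ℚ ≤ℚ g u v
    atmost1  : ∀ u v → g u v ≤ℚ 1ℚ
    sum1     : ∀ v → v ∉ verts S → Σᵥ (g v) ≡ 1ℚ

HasFPM : VertexSet → EdgeSet → Set
HasFPM S D = FPM S D

∅V : VertexSet
∅V = record { verts = Data.List.[] ; vuniq = Data.List.Relation.Unary.AllPairs.[] }
  where import Data.List.Relation.Unary.AllPairs

size : VertexSet → EdgeSet → ℕ
size S D = length (verts S) + length (edges D)

FSMP≡ : ℕ → Set
FSMP≡ k =
  Σ VertexSet (λ S → Σ EdgeSet (λ D → size S D ≡ k × ¬ HasFPM S D))
  × (∀ (S : VertexSet) (D : EdgeSet) → size S D < k → HasFPM S D)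

FMP≡ : ℕ → Set
FMP≡ k =
  Σ EdgeSet (λ D → length (edges D) ≡ k × ¬ HasFPM ∅V D)
  × (∀ (D : EdgeSet) → length (edges D) < k → HasFPM ∅V D)

-- Deleting the four edges at vertex 0, or vertex 0 together with the edges 1 2 and 9 10, leaves no
-- fractional perfect matching: this is certified by a vertex weighting y that vanishes on deleted
-- vertices, satisfies y u + y v ≥ 0 on every surviving edge and has negative total (weak LP duality).
-- Conversely, G has four edge-disjoint perfect matchings, so three deleted edges always miss one;
-- G − a has two edge-disjoint half-integral fractional perfect matchings, so one deleted edge misses
-- one of them; and G − {a , b} has one. The latter are explicit tables for a = 0 rotated to a, and
-- all tables are verified by computation.

module Submission where

open import Defs
open import Algebra.Bundles using (CommutativeRing)
open import Data.Bool using (if_then_else_; _∧_)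
open import Data.Empty using (⊥-elim)
open import Data.Fin using (Fin; zero; suc; toℕ; #_)
open import Data.Fin.Properties using (all?; any?; ¬∀⟶∃¬; <⇒notInjective)
  renaming (_≟_ to _≟ᶠ_)
open import Data.List using (List; []; _∷_; length; map; lookup)
open import Data.List.Membership.Propositional using (_∈_; _∉_)
open import Data.List.Membership.Propositional.Properties using (∈-map⁺)
import Data.List.Membership.DecPropositional as DecMembership
open import Data.List.Properties using (length-map)
open import Data.List.Relation.Unary.All as All using (All; []; _∷_)
import Data.List.Relation.Unary.AllPairs as AllPairs
open import Data.List.Relation.Unary.Any using (index)
open import Data.List.Relation.Unary.Any.Properties using (lookup-index)
open import Data.Nat as ℕ using (ℕ; zero; suc; _+_; _≤_; _<_; s≤s; z≤n; _≡ᵇ_; _%_)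
import Data.Nat.Properties as ℕ
open import Data.Product using (_×_; _,_; ∃)
open import Data.Product.Properties using (≡-dec)
open import Data.Rational using (ℚ; 0ℚ; 1ℚ; ½; -_; nonNegative)
  renaming (_+_ to _+ℚ_; _*_ to _*ℚ_; _≤_ to _≤ℚ_; _<_ to _<ℚ_)
import Data.Rational.Properties as ℚ
open import Data.Sum using (_⊎_; inj₁; inj₂)
import Data.Vec as Vec
open import Data.Vec using (_∷_; [])
open import Function using (_∘_; Injective)
open import Relation.Binary.PropositionalEquality
  using (_≡_; _≢_; refl; sym; trans; cong; cong₂; subst; module ≡-Reasoning)
open import Relation.Nullary using (¬_; Dec; yes; no; ¬?)
open import Relation.Nullary.Decidable using (True; toWitness; from-yes; _×-dec_; _⊎-dec_; _→-dec_)

open import Algebra.Properties.Semiring.Sum (CommutativeRing.semiring ℚ.+-*-commutativeRing)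
  using (sum; sum-cong-≗; ∑-comm; ∑-distrib-+; *-distribˡ-sum)
import Algebra.Properties.Monoid.Sum ℕ.+-0-monoid as ℕΣ

open DecMembership (_≟ᶠ_ {16}) using (_∈?_)

_∈ₑ?_ : ∀ (e : V × V) es → Dec (e ∈ es)
_∈ₑ?_ = DecMembership._∈?_ (≡-dec _≟ᶠ_ _≟ᶠ_)

Adj? : ∀ u v → Dec (Adj u v)
Adj? u v = diff u v ℕ.≟ 1 ⊎-dec diff u v ℕ.≟ 15 ⊎-dec diff u v ℕ.≟ 4 ⊎-dec diff u v ℕ.≟ 12

IsEdge? : ∀ e → Dec (IsEdge e)
IsEdge? (u , v) = toℕ u ℕ.<? toℕ v ×-dec Adj? u v

EdgeIn? : ∀ S D u v → Dec (EdgeIn S D u v)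
EdgeIn? S D u v =
  Adj? u v ×-dec ¬? (u ∈? verts S) ×-dec ¬? (v ∈? verts S)
    ×-dec ¬? ((u , v) ∈ₑ? edges D) ×-dec ¬? ((v , u) ∈ₑ? edges D)

sum-nonneg : ∀ {n} (f : Fin n → ℚ) → (∀ i → 0ℚ ≤ℚ f i) → 0ℚ ≤ℚ sum f
sum-nonneg {zero}  f f≥0 = ℚ.≤-refl
sum-nonneg {suc n} f f≥0 = ℚ.+-mono-≤ (f≥0 zero) (sum-nonneg (f ∘ suc) (f≥0 ∘ suc))

*-nonneg : ∀ {p q} → 0ℚ ≤ℚ p → 0ℚ ≤ℚ q → 0ℚ ≤ℚ p *ℚ q
*-nonneg {p} {q} 0≤p 0≤q =
  ℚ.nonNegative⁻¹ (p *ℚ q) {{ℚ.nonNeg*nonNeg⇒nonNeg p {{nonNegative 0≤p}} q {{nonNegative 0≤q}}}}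

halves : ℕ → ℚ
halves zero    = 0ℚ
halves (suc n) = ½ +ℚ halves n

halves-+ : ∀ m n → halves (m + n) ≡ halves m +ℚ halves n
halves-+ zero    n = sym (ℚ.+-identityˡ (halves n))
halves-+ (suc m) n = trans (cong (½ +ℚ_) (halves-+ m n)) (sym (ℚ.+-assoc ½ (halves m) (halves n)))

sum-halves : ∀ {n} (f : Fin n → ℕ) → sum (halves ∘ f) ≡ halves (ℕΣ.sum f)
sum-halves {zero}  f = refl
sum-halves {suc n} f =
  trans (cong (halves (f zero) +ℚ_) (sum-halves (f ∘ suc))) (sym (halves-+ (f zero) _))

halves-nonneg : ∀ n → 0ℚ ≤ℚ halves n
halves-nonneg zero    = ℚ.≤-refl
halves-nonneg (suc n) = ℚ.+-mono-≤ (from-yes (0ℚ ℚ.≤? ½)) (halves-nonneg n)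

halves-≤1 : ∀ {n} → n ≤ 2 → halves n ≤ℚ 1ℚ
halves-≤1 z≤n             = from-yes (halves 0 ℚ.≤? 1ℚ)
halves-≤1 (s≤s z≤n)       = from-yes (halves 1 ℚ.≤? 1ℚ)
halves-≤1 (s≤s (s≤s z≤n)) = ℚ.≤-refl

IsObstruction : VertexSet → EdgeSet → (V → ℚ) → Set
IsObstruction S D y =
    (∀ u v → EdgeIn S D u v → 0ℚ ≤ℚ y u +ℚ y v)
  × (∀ v → v ∈ verts S → y v ≡ 0ℚ)
  × Σᵥ y <ℚ 0ℚ

isObstruction? : ∀ S D y → Dec (IsObstruction S D y)
isObstruction? S D y =
  all? (λ u → all? λ v → EdgeIn? S D u v →-dec 0ℚ ℚ.≤? y u +ℚ y v)
    ×-dec all? (λ v → v ∈? verts S →-dec y v ℚ.≟ 0ℚ)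
    ×-dec Σᵥ y ℚ.<? 0ℚ

-- Pairing y with the vertex constraints of g counts every edge from both ends:
-- 2 Σᵥ y = Σ (y u + y v) g(u,v) ≥ 0.
obstruction⇒¬FPM : ∀ {S D} y → IsObstruction S D y → ¬ FPM S D
obstruction⇒¬FPM {S} {D} y (y-edge , y-deleted , Σy<0) m =
  ℚ.<-irrefl refl (ℚ.<-≤-trans (ℚ.+-mono-< Σy<0 Σy<0) 0≤2Σy)
  where
  open FPM m renaming (sym to g-sym)
  open ≡-Reasoning

  row-weighted : ∀ v → y v *ℚ Σᵥ (g v) ≡ y v
  row-weighted v with v ∈? verts S
  ... | yes v∈S rewrite y-deleted v v∈S = ℚ.*-zeroˡ (Σᵥ (g v))
  ... | no  v∉S = trans (cong (y v *ℚ_) (sum1 v v∉S)) (ℚ.*-identityʳ (y v))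

  Σy≡rows : Σᵥ y ≡ sum (λ v → sum (λ u → y v *ℚ g v u))
  Σy≡rows = trans (sum-cong-≗ (sym ∘ row-weighted)) (sum-cong-≗ (λ v → *-distribˡ-sum (y v) (g v)))

  Σy≡cols : Σᵥ y ≡ sum (λ v → sum (λ u → y u *ℚ g v u))
  Σy≡cols = begin
    Σᵥ y                                 ≡⟨ Σy≡rows ⟩
    sum (λ u → sum (λ v → y u *ℚ g u v)) ≡⟨ sum-cong-≗ (λ u → sum-cong-≗ (cong (y u *ℚ_) ∘ g-sym u)) ⟩
    sum (λ u → sum (λ v → y u *ℚ g v u)) ≡⟨ ∑-comm (λ u v → y u *ℚ g v u) ⟩
    sum (λ v → sum (λ u → y u *ℚ g v u)) ∎

  2Σy≡ : Σᵥ y +ℚ Σᵥ y ≡ sum (λ v → sum (λ u → (y v +ℚ y u) *ℚ g v u))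
  2Σy≡ = begin
    Σᵥ y +ℚ Σᵥ y
      ≡⟨ cong₂ _+ℚ_ Σy≡rows Σy≡cols ⟩
    sum (λ v → sum (λ u → y v *ℚ g v u)) +ℚ sum (λ v → sum (λ u → y u *ℚ g v u))
      ≡⟨ sym (∑-distrib-+ (λ v → sum (λ u → y v *ℚ g v u)) (λ v → sum (λ u → y u *ℚ g v u))) ⟩
    sum (λ v → sum (λ u → y v *ℚ g v u) +ℚ sum (λ u → y u *ℚ g v u))
      ≡⟨ sum-cong-≗ (λ v → sym (∑-distrib-+ (λ u → y v *ℚ g v u) (λ u → y u *ℚ g v u))) ⟩
    sum (λ v → sum (λ u → y v *ℚ g v u +ℚ y u *ℚ g v u))
      ≡⟨ sum-cong-≗ (λ v → sum-cong-≗ (λ u → sym (ℚ.*-distribʳ-+ (g v u) (y v) (y u)))) ⟩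
    sum (λ v → sum (λ u → (y v +ℚ y u) *ℚ g v u)) ∎

  term-nonneg : ∀ v u → 0ℚ ≤ℚ (y v +ℚ y u) *ℚ g v u
  term-nonneg v u with EdgeIn? S D v u
  ... | yes e  = *-nonneg (y-edge v u e) (nonneg v u)
  ... | no  ¬e = ℚ.≤-reflexive (sym (trans (cong ((y v +ℚ y u) *ℚ_) (support v u ¬e)) (ℚ.*-zeroʳ (y v +ℚ y u))))

  0≤2Σy : 0ℚ ≤ℚ Σᵥ y +ℚ Σᵥ y
  0≤2Σy = subst (0ℚ ≤ℚ_) (sym 2Σy≡) (sum-nonneg _ λ v → sum-nonneg _ (term-nonneg v))

-- An entry (a , b , w) puts weight w/2 on the edge {a , b}.
Table : Set
Table = List (ℕ × ℕ × ℕ)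

directedWeight : Table → V → V → ℕ
directedWeight []                u v = 0
directedWeight ((a , b , w) ∷ t) u v =
  if (a ≡ᵇ toℕ u) ∧ (b ≡ᵇ toℕ v) then w else directedWeight t u v

weight : Table → V → V → ℕ
weight t u v = directedWeight t u v + directedWeight t v u

weight-sym : ∀ t u v → weight t u v ≡ weight t v u
weight-sym t u v = ℕ.+-comm (directedWeight t u v) (directedWeight t v u)

-- u ↦ u + a is an automorphism of the circulant G.
rotate : V → Table → Table
rotate a = map λ (u , v , w) → ((u + toℕ a) % 16 , (v + toℕ a) % 16 , w)

IsHalfFPM : List V → Table → Set
IsHalfFPM X t =
    (∀ u v → weight t u v ≤ 2)
  × (∀ u v → weight t u v ≢ 0 → Adj u v × u ∉ X × v ∉ X)
  × (∀ v → v ∉ X → ℕΣ.sum (weight t v) ≡ 2)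

isHalfFPM? : ∀ X t → Dec (IsHalfFPM X t)
isHalfFPM? X t =
  all? (λ u → all? λ v → weight t u v ℕ.≤? 2)
    ×-dec all? (λ u → all? λ v → ¬? (weight t u v ℕ.≟ 0) →-dec Adj? u v ×-dec ¬? (u ∈? X) ×-dec ¬? (v ∈? X))
    ×-dec all? (λ v → ¬? (v ∈? X) →-dec ℕΣ.sum (weight t v) ℕ.≟ 2)

Avoids : Table → V × V → Set
Avoids t (u , v) = weight t u v ≡ 0

halfFPM⇒FPM : ∀ {S D} t → IsHalfFPM (verts S) t → All (Avoids t) (edges D) → FPM S D
halfFPM⇒FPM {S} {D} t (≤2 , on-edges , degree) avoids-D = record
  { g       = g
  ; sym     = λ u v → cong halves (weight-sym t u v)
  ; support = support
  ; nonneg  = λ u v → halves-nonneg (weight t u v)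
  ; atmost1 = λ u v → halves-≤1 (≤2 u v)
  ; sum1    = λ v v∉S → trans (sum-halves (weight t v)) (cong halves (degree v v∉S))
  }
  where
  g : V → V → ℚ
  g u v = halves (weight t u v)

  support : ∀ u v → ¬ EdgeIn S D u v → g u v ≡ 0ℚ
  support u v ¬e with weight t u v ℕ.≟ 0
  ... | yes w≡0 = cong halves w≡0
  ... | no  w≢0 =
    let (adj , u∉S , v∉S) = on-edges u v w≢0
    in ⊥-elim (¬e (adj , u∉S , v∉S
                  , (λ uv∈D → w≢0 (All.lookup avoids-D uv∈D))
                  , (λ vu∈D → w≢0 (trans (weight-sym t u v) (All.lookup avoids-D vu∈D)))))

∃-∉ : ∀ {n} (xs : List (Fin n)) → length xs < n → ∃ λ k → k ∉ xs
∃-∉ {n} xs |xs|<n =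
  ¬∀⟶∃¬ n (_∈ xs) (λ k → DecMembership._∈?_ _≟ᶠ_ k xs)
    λ all∈ → <⇒notInjective |xs|<n (index-injective all∈)
  where
  index-injective : (all∈ : ∀ k → k ∈ xs) → Injective _≡_ _≡_ (λ k → index (all∈ k))
  index-injective all∈ {k} {l} eq =
    trans (lookup-index (all∈ k)) (trans (cong (lookup xs) eq) (sym (lookup-index (all∈ l))))

EdgeDisjoint : ∀ {n} → (Fin n → Table) → Set
EdgeDisjoint ts = ∀ k l u v → weight (ts k) u v ≢ 0 → weight (ts l) u v ≢ 0 → k ≡ l

edgeDisjoint? : ∀ {n} (ts : Fin n → Table) → Dec (EdgeDisjoint ts)
edgeDisjoint? ts =
  all? λ k → all? λ l → all? λ u → all? λ v →
    ¬? (weight (ts k) u v ℕ.≟ 0) →-dec ¬? (weight (ts l) u v ℕ.≟ 0) →-dec k ≟ᶠ l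

some-table-avoids : ∀ {n} (ts : Fin n → Table) → EdgeDisjoint ts →
                    (es : List (V × V)) → length es < n → ∃ λ k → All (Avoids (ts k)) es
some-table-avoids {suc n} ts disjoint es |es|<n =
  let (k , k∉owners) = ∃-∉ (map owner es) (subst (_< suc n) (sym (length-map owner es)) |es|<n)
  in k , All.tabulate λ {e} e∈es → avoids k∉owners e∈es (owner-spec k e)
  where
  owner : V × V → Fin (suc n)
  owner (u , v) with any? (λ k → ¬? (weight (ts k) u v ℕ.≟ 0))
  ... | yes (k , _) = k
  ... | no  _       = zero

  owner-spec : ∀ k e → Avoids (ts k) e ⊎ k ≡ owner e
  owner-spec k (u , v) with weight (ts k) u v ℕ.≟ 0
  ... | yes w≡0 = inj₁ w≡0
  ... | no  w≢0 with any? (λ l → ¬? (weight (ts l) u v ℕ.≟ 0))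
  ...   | yes (l , w′≢0) = inj₂ (disjoint k l u v w≢0 w′≢0)
  ...   | no  none       = ⊥-elim (none (k , w≢0))

  avoids : ∀ {k e} → k ∉ map owner es → e ∈ es → Avoids (ts k) e ⊎ k ≡ owner e → Avoids (ts k) e
  avoids k∉owners e∈es (inj₁ avoids-e) = avoids-e
  avoids k∉owners e∈es (inj₂ refl)     = ⊥-elim (k∉owners (∈-map⁺ owner e∈es))

fpm-avoiding : ∀ {n S D} (ts : Fin n → Table) → (∀ k → IsHalfFPM (verts S) (ts k)) →
               EdgeDisjoint ts → length (edges D) < n → FPM S D
fpm-avoiding ts halfFPM disjoint |D|<n =
  let (k , avoids) = some-table-avoids ts disjoint _ |D|<n
  in halfFPM⇒FPM (ts k) (halfFPM k) avoids

perfectMatching : Fin 4 → Table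
perfectMatching zero =
  (0 , 1 , 2) ∷ (2 , 3 , 2) ∷ (4 , 5 , 2) ∷ (6 , 7 , 2) ∷ (8 , 9 , 2) ∷ (10 , 11 , 2) ∷
  (12 , 13 , 2) ∷ (14 , 15 , 2) ∷ []
perfectMatching (suc zero) =
  (1 , 2 , 2) ∷ (3 , 4 , 2) ∷ (5 , 6 , 2) ∷ (7 , 8 , 2) ∷ (9 , 10 , 2) ∷ (11 , 12 , 2) ∷
  (13 , 14 , 2) ∷ (15 , 0 , 2) ∷ []
perfectMatching (suc (suc zero)) =
  (0 , 4 , 2) ∷ (1 , 5 , 2) ∷ (2 , 6 , 2) ∷ (3 , 7 , 2) ∷ (8 , 12 , 2) ∷ (9 , 13 , 2) ∷
  (10 , 14 , 2) ∷ (11 , 15 , 2) ∷ []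
perfectMatching (suc (suc (suc zero))) =
  (4 , 8 , 2) ∷ (5 , 9 , 2) ∷ (6 , 10 , 2) ∷ (7 , 11 , 2) ∷ (12 , 0 , 2) ∷ (13 , 1 , 2) ∷
  (14 , 2 , 2) ∷ (15 , 3 , 2) ∷ []

fpmMinus0 : Fin 2 → Table
fpmMinus0 zero =
  (1 , 5 , 2) ∷ (2 , 3 , 1) ∷ (2 , 14 , 1) ∷ (3 , 4 , 1) ∷ (4 , 8 , 1) ∷ (6 , 7 , 2) ∷
  (8 , 12 , 1) ∷ (9 , 10 , 2) ∷ (11 , 15 , 2) ∷ (12 , 13 , 1) ∷ (13 , 14 , 1) ∷ []
fpmMinus0 (suc _) =
  (1 , 2 , 1) ∷ (1 , 13 , 1) ∷ (2 , 6 , 1) ∷ (3 , 7 , 1) ∷ (3 , 15 , 1) ∷ (4 , 5 , 2) ∷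
  (6 , 10 , 1) ∷ (7 , 8 , 1) ∷ (8 , 9 , 1) ∷ (9 , 13 , 1) ∷ (10 , 14 , 1) ∷ (11 , 12 , 2) ∷
  (14 , 15 , 1) ∷ []

-- A fractional perfect matching of G − {0 , d} for 0 < d < 16, and of G − 0 for d = 0.
fpmMinus0And : ℕ → Table
fpmMinus0And 0 = fpmMinus0 zero
fpmMinus0And 1 =
  (2 , 6 , 1) ∷ (2 , 14 , 1) ∷ (3 , 15 , 2) ∷ (4 , 5 , 1) ∷ (4 , 8 , 1) ∷ (5 , 6 , 1) ∷
  (7 , 11 , 2) ∷ (8 , 9 , 1) ∷ (9 , 10 , 1) ∷ (10 , 14 , 1) ∷ (12 , 13 , 2) ∷ []
fpmMinus0And 2 =
  (1 , 5 , 1) ∷ (1 , 13 , 1) ∷ (3 , 4 , 1) ∷ (3 , 15 , 1) ∷ (4 , 5 , 1) ∷ (6 , 7 , 2) ∷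
  (8 , 9 , 2) ∷ (10 , 11 , 1) ∷ (10 , 14 , 1) ∷ (11 , 12 , 1) ∷ (12 , 13 , 1) ∷ (14 , 15 , 1) ∷ []
fpmMinus0And 3 =
  (1 , 2 , 1) ∷ (1 , 13 , 1) ∷ (2 , 6 , 1) ∷ (4 , 5 , 2) ∷ (6 , 7 , 1) ∷ (7 , 8 , 1) ∷
  (8 , 12 , 1) ∷ (9 , 10 , 1) ∷ (9 , 13 , 1) ∷ (10 , 14 , 1) ∷ (11 , 12 , 1) ∷ (11 , 15 , 1) ∷
  (14 , 15 , 1) ∷ []
fpmMinus0And 4 =
  (1 , 5 , 1) ∷ (1 , 13 , 1) ∷ (2 , 14 , 2) ∷ (3 , 15 , 2) ∷ (5 , 6 , 1) ∷ (6 , 7 , 1) ∷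
  (7 , 8 , 1) ∷ (8 , 9 , 1) ∷ (9 , 10 , 1) ∷ (10 , 11 , 1) ∷ (11 , 12 , 1) ∷ (12 , 13 , 1) ∷ []
fpmMinus0And 5 =
  (1 , 2 , 1) ∷ (1 , 13 , 1) ∷ (2 , 6 , 1) ∷ (3 , 4 , 1) ∷ (3 , 15 , 1) ∷ (4 , 8 , 1) ∷
  (6 , 7 , 1) ∷ (7 , 8 , 1) ∷ (9 , 10 , 1) ∷ (9 , 13 , 1) ∷ (10 , 14 , 1) ∷ (11 , 12 , 2) ∷
  (14 , 15 , 1) ∷ []
fpmMinus0And 6 =
  (1 , 2 , 2) ∷ (3 , 15 , 2) ∷ (4 , 5 , 2) ∷ (7 , 11 , 2) ∷ (8 , 9 , 1) ∷ (8 , 12 , 1) ∷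
  (9 , 13 , 1) ∷ (10 , 14 , 2) ∷ (12 , 13 , 1) ∷ []
fpmMinus0And 7 =
  (1 , 2 , 1) ∷ (1 , 5 , 1) ∷ (2 , 14 , 1) ∷ (3 , 15 , 2) ∷ (4 , 5 , 1) ∷ (4 , 8 , 1) ∷
  (6 , 10 , 2) ∷ (8 , 9 , 1) ∷ (9 , 13 , 1) ∷ (11 , 12 , 2) ∷ (13 , 14 , 1) ∷ []
fpmMinus0And 8 =
  (1 , 13 , 2) ∷ (2 , 3 , 1) ∷ (2 , 14 , 1) ∷ (3 , 15 , 1) ∷ (4 , 5 , 2) ∷ (6 , 7 , 2) ∷
  (9 , 10 , 2) ∷ (11 , 12 , 2) ∷ (14 , 15 , 1) ∷ []
fpmMinus0And 9 =
  (1 , 5 , 1) ∷ (1 , 13 , 1) ∷ (2 , 6 , 1) ∷ (2 , 14 , 1) ∷ (3 , 15 , 2) ∷ (4 , 5 , 1) ∷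
  (4 , 8 , 1) ∷ (6 , 7 , 1) ∷ (7 , 11 , 1) ∷ (8 , 12 , 1) ∷ (10 , 11 , 1) ∷ (10 , 14 , 1) ∷
  (12 , 13 , 1) ∷ []
fpmMinus0And 10 =
  (1 , 2 , 1) ∷ (1 , 5 , 1) ∷ (2 , 14 , 1) ∷ (3 , 15 , 2) ∷ (4 , 5 , 1) ∷ (4 , 8 , 1) ∷
  (6 , 7 , 2) ∷ (8 , 9 , 1) ∷ (9 , 13 , 1) ∷ (11 , 12 , 2) ∷ (13 , 14 , 1) ∷ []
fpmMinus0And 11 =
  (1 , 13 , 2) ∷ (2 , 3 , 1) ∷ (2 , 14 , 1) ∷ (3 , 15 , 1) ∷ (4 , 5 , 2) ∷ (6 , 7 , 2) ∷
  (8 , 12 , 2) ∷ (9 , 10 , 2) ∷ (14 , 15 , 1) ∷ []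
fpmMinus0And 12 =
  (1 , 5 , 1) ∷ (1 , 13 , 1) ∷ (2 , 6 , 1) ∷ (2 , 14 , 1) ∷ (3 , 15 , 2) ∷ (4 , 5 , 1) ∷
  (4 , 8 , 1) ∷ (6 , 10 , 1) ∷ (7 , 11 , 2) ∷ (8 , 9 , 1) ∷ (9 , 13 , 1) ∷ (10 , 14 , 1) ∷ []
fpmMinus0And 13 =
  (1 , 2 , 1) ∷ (1 , 5 , 1) ∷ (2 , 14 , 1) ∷ (3 , 15 , 2) ∷ (4 , 5 , 1) ∷ (4 , 8 , 1) ∷
  (6 , 7 , 2) ∷ (8 , 9 , 1) ∷ (9 , 10 , 1) ∷ (10 , 14 , 1) ∷ (11 , 12 , 2) ∷ []
fpmMinus0And 14 =
  (1 , 2 , 1) ∷ (1 , 13 , 1) ∷ (2 , 6 , 1) ∷ (3 , 7 , 1) ∷ (3 , 15 , 1) ∷ (4 , 5 , 2) ∷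
  (6 , 10 , 1) ∷ (7 , 8 , 1) ∷ (8 , 12 , 1) ∷ (9 , 10 , 1) ∷ (9 , 13 , 1) ∷ (11 , 12 , 1) ∷
  (11 , 15 , 1) ∷ []
fpmMinus0And 15 =
  (1 , 5 , 1) ∷ (1 , 13 , 1) ∷ (2 , 14 , 2) ∷ (3 , 4 , 1) ∷ (3 , 7 , 1) ∷ (4 , 5 , 1) ∷
  (6 , 10 , 2) ∷ (7 , 8 , 1) ∷ (8 , 9 , 1) ∷ (9 , 13 , 1) ∷ (11 , 12 , 2) ∷ []
fpmMinus0And _ = []

fpmsMinus : V → Fin 2 → Table
fpmsMinus a = rotate a ∘ fpmMinus0

fpmMinus : V → V → Table
fpmMinus a b = rotate a (fpmMinus0And (diff a b))

perfectMatching-halfFPM : ∀ k → IsHalfFPM [] (perfectMatching k)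
perfectMatching-halfFPM = from-yes (all? λ k → isHalfFPM? [] (perfectMatching k))

perfectMatching-disjoint : EdgeDisjoint perfectMatching
perfectMatching-disjoint = from-yes (edgeDisjoint? perfectMatching)

fpmsMinus-halfFPM : ∀ a k → IsHalfFPM (a ∷ []) (fpmsMinus a k)
fpmsMinus-halfFPM = from-yes (all? λ a → all? λ k → isHalfFPM? (a ∷ []) (fpmsMinus a k))

fpmsMinus-disjoint : ∀ a → EdgeDisjoint (fpmsMinus a)
fpmsMinus-disjoint = from-yes (all? λ a → edgeDisjoint? (fpmsMinus a))

fpmMinus-halfFPM : ∀ a b → IsHalfFPM (a ∷ b ∷ []) (fpmMinus a b)
fpmMinus-halfFPM = from-yes (all? λ a → all? λ b → isHalfFPM? (a ∷ b ∷ []) (fpmMinus a b))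

fsmp-lower : ∀ S D → size S D < 3 → HasFPM S D
fsmp-lower record { verts = [] } D |D|<3 =
  fpm-avoiding perfectMatching perfectMatching-halfFPM perfectMatching-disjoint (ℕ.m<n⇒m<1+n |D|<3)
fsmp-lower record { verts = a ∷ [] } D (s≤s |D|<2) =
  fpm-avoiding (fpmsMinus a) (fpmsMinus-halfFPM a) (fpmsMinus-disjoint a) |D|<2
fsmp-lower record { verts = a ∷ b ∷ [] } record { edges = [] } _ =
  halfFPM⇒FPM (fpmMinus a b) (fpmMinus-halfFPM a b) []
fsmp-lower record { verts = _ ∷ _ ∷ [] } record { edges = _ ∷ _ } (s≤s (s≤s (s≤s ())))
fsmp-lower record { verts = _ ∷ _ ∷ _ ∷ _ } D (s≤s (s≤s (s≤s ())))

fmp-lower : ∀ D → length (edges D) < 4 → HasFPM ∅V D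
fmp-lower D = fpm-avoiding perfectMatching perfectMatching-halfFPM perfectMatching-disjoint

edgeSet : (es : List (V × V))
          {valid : True (All.all? IsEdge? es)}
          {unique : True (AllPairs.allPairs? (λ e e′ → ¬? (≡-dec _≟ᶠ_ _≟ᶠ_ e e′)) es)} →
          EdgeSet
edgeSet es {valid} {unique} = record { edges = es ; valid = toWitness valid ; unique = toWitness unique }

-1ℚ : ℚ
-1ℚ = - 1ℚ

mixedCutVertices : VertexSet
mixedCutVertices = record { verts = # 0 ∷ [] ; vuniq = [] AllPairs.∷ AllPairs.[] }

mixedCutEdges : EdgeSet
mixedCutEdges = edgeSet ((# 1 , # 2) ∷ (# 9 , # 10) ∷ [])

-- In G − 0 − {1 2 , 9 10} the eight vertices 1 2 4 7 9 10 12 15 (weight −1) are independent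
-- and all their neighbours lie among the seven vertices 3 5 6 8 11 13 14 (weight 1).
mixedCutCertificate : V → ℚ
mixedCutCertificate = Vec.lookup
  (0ℚ ∷ -1ℚ ∷ -1ℚ ∷ 1ℚ ∷ -1ℚ ∷ 1ℚ ∷ 1ℚ ∷ -1ℚ ∷ 1ℚ ∷ -1ℚ ∷ -1ℚ ∷ 1ℚ ∷ -1ℚ ∷ 1ℚ ∷ 1ℚ ∷ -1ℚ ∷ [])

mixedCut-obstruction : IsObstruction mixedCutVertices mixedCutEdges mixedCutCertificate
mixedCut-obstruction = from-yes (isObstruction? mixedCutVertices mixedCutEdges mixedCutCertificate)

edgesAt0 : EdgeSet
edgesAt0 = edgeSet ((# 0 , # 1) ∷ (# 0 , # 4) ∷ (# 0 , # 12) ∷ (# 0 , # 15) ∷ [])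

isolate0 : V → ℚ
isolate0 = Vec.lookup (-1ℚ ∷ Vec.replicate 15 0ℚ)

edgesAt0-obstruction : IsObstruction ∅V edgesAt0 isolate0
edgesAt0-obstruction = from-yes (isObstruction? ∅V edgesAt0 isolate0)

lemma4p18 : FSMP≡ 3 × FMP≡ 4
lemma4p18 =
  ( (mixedCutVertices , mixedCutEdges , refl , obstruction⇒¬FPM mixedCutCertificate mixedCut-obstruction)
  , fsmp-lower )
  , ( (edgesAt0 , refl , obstruction⇒¬FPM isolate0 edgesAt0-obstruction)
  , fmp-lower )
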